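{- Let $G$ be a connected finite $\delta$-hyperbolic graph and let $\{x,y\}$ be a mutually distant pair of vertices. Every vertex $c\in S_{\lceil d(x,y)/2\rceil}(x,y)\cup S_{\lceil d(x,y)/2\rceil}(y,x)$ satisfies $C_{\le k}(G)\subseteq D(c,4\delta+1+k)$ for every integer $k\ge0$. In particular, $C(G)\subseteq D(c,4\delta+1)$.
   Context: $G$ is $\delta$-hyperbolic if for any four vertices $u,v,w,x$ the two larger of $d(u,v)+d(w,x)$, $d(u,w)+d(v,x)$, $d(u,x)+d(v,w)$ differ by at most $2\delta$ ($d$ = shortest-path distance). $e(v)=\max_u d(v,u)$, $F(v)=\{u:d(u,v)=e(v)\}$; $\{x,y\}$ is mutually distant if $x\in F(y)$ and $y\in F(x)$. $rad(G)=\min_v e(v)$, $C_{\le k}(G)=\{v:e(v)\le rad(G)+k\}$, $C(G)=C_{\le 0}(G)$, $D(c,r)=\{u:d(u,c)\le r\}$. $I(x,y)=\{w: d(x,w)+d(w,y)=d(x,y)\}$, $S_k(x,y)=\{v\in I(x,y): d(v,x)=k\}$. -}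

module Defs where

open import Data.Nat using (ℕ; zero; suc; _+_; _≤_; _⊔_; _⊓_; ⌈_/2⌉)
open import Data.Fin using (Fin)
open import Data.List using (List; foldr; map)
open import Data.Fin.Base using () renaming (zero to fzero)
open import Data.Product using (_×_)
open import Relation.Nullary using (¬_)
open import Relation.Binary.PropositionalEquality using (_≡_)

import Data.List.Base as L

record Graph (n : ℕ) : Set₁ where
  field
    Adj       : Fin n → Fin n → Set
    Adj-sym   : ∀ {u v} → Adj u v → Adj v u
    Adj-irrefl : ∀ {u} → ¬ Adj u u

data Walk {n : ℕ} (G : Graph n) : Fin n → Fin n → ℕ → Set where
  here : ∀ {u} → Walk G u u 0
  step : ∀ {u w v k} → Graph.Adj G u w → Walk G w v k → Walk G u v (suc k)

Connected : ∀ {n} → Graph n → Set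
Connected {n} G = ∀ (u v : Fin n) → Σ' u v
  where
  open import Data.Product using (∃)
  Σ' : Fin n → Fin n → Set
  Σ' u v = ∃ λ k → Walk G u v k

IsShortestPathDistance : ∀ {n} → Graph n → (Fin n → Fin n → ℕ) → Set
IsShortestPathDistance G d =
  ∀ u v → Walk G u v (d u v) × (∀ k → Walk G u v k → d u v ≤ k)

-- Four-point condition with parameter t = 2δ:
-- the largest of the three pair sums is at most the second largest + t,
-- i.e. the two larger sums differ by at most 2δ.
Hyperbolic : ∀ {n} → (Fin n → Fin n → ℕ) → ℕ → Set
Hyperbolic {n} d t = ∀ (u v w x : Fin n) →
  let s₁ = d u v + d w x
      s₂ = d u w + d v x
      s₃ = d u x + d v w
  in (s₁ ≤ (s₂ ⊔ s₃) + t) × (s₂ ≤ (s₁ ⊔ s₃) + t) × (s₃ ≤ (s₁ ⊔ s₂) + t)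

ecc : ∀ {n} → (Fin n → Fin n → ℕ) → Fin n → ℕ
ecc {n} d v = foldr (λ u m → d v u ⊔ m) 0 (L.allFin n)

rad : ∀ {n} → (Fin (suc n) → Fin (suc n) → ℕ) → ℕ
rad {n} d = foldr (λ v m → ecc d v ⊓ m) (ecc d fzero) (L.allFin (suc n))

InFar : ∀ {n} → (Fin n → Fin n → ℕ) → Fin n → Fin n → Set
InFar d u v = d u v ≡ ecc d v

MutuallyDistant : ∀ {n} → (Fin n → Fin n → ℕ) → Fin n → Fin n → Set
MutuallyDistant d x y = InFar d x y × InFar d y x

InCentre≤ : ∀ {n} → (Fin (suc n) → Fin (suc n) → ℕ) → ℕ → Fin (suc n) → Set
InCentre≤ d k v = ecc d v ≤ rad d + k

InDisk : ∀ {n} → (Fin n → Fin n → ℕ) → Fin n → ℕ → Fin n → Set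
InDisk d c r u = d u c ≤ r

InInterval : ∀ {n} → (Fin n → Fin n → ℕ) → Fin n → Fin n → Fin n → Set
InInterval d x y w = d x w + d w y ≡ d x y

InSlice : ∀ {n} → (Fin n → Fin n → ℕ) → ℕ → Fin n → Fin n → Fin n → Set
InSlice d k x y v = InInterval d x y v × d v x ≡ k

-- Let D = d(x,y) and h = ⌈D/2⌉. A vertex c of the slice is within h of both x and y,
-- and by mutual distance every vertex is within D of both x and y. The four-point
-- condition on (x, y, c, u) then gives D + d(c,u) ≤ h + D + 2δ, so rad(G) ≤ e(c) ≤ h + 2δ.
-- For v ∈ C_{≤k}(G) all distances from v are at most R = h + 2δ + k, and the four-point
-- condition on (x, y, v, c) gives D + d(v,c) ≤ R + h + 2δ ≤ D + 4δ + 1 + k, using 2h ≤ D + 1.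
module Submission where

open import Defs
open import Data.Nat using (ℕ; suc; _+_; ⌈_/2⌉)
open import Data.Fin using (Fin)
open import Data.Sum using (_⊎_)

open import Data.Nat using (_≤_; _⊔_; _⊓_; ⌊_/2⌋; z≤n)
open import Data.Nat.Properties
open import Data.Nat.Solver using (module +-*-Solver)
open import Data.Fin.Base using () renaming (zero to fzero)
open import Data.Product using (_×_; _,_; proj₁; proj₂; swap)
open import Data.Sum using (inj₁; inj₂)
open import Data.List.Base using (List; []; _∷_; foldr; allFin)
open import Data.List.Relation.Unary.Any using (here; there)
open import Data.List.Membership.Propositional using (_∈_)
open import Data.List.Membership.Propositional.Properties using (∈-allFin)
open import Relation.Binary.PropositionalEquality

module _ {n : ℕ} (G : Graph n) where
  open Graph G

  walk-snoc : ∀ {u v w k} → Walk G u v k → Adj v w → Walk G u w (suc k)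
  walk-snoc here       a = step a here
  walk-snoc (step b p) a = step b (walk-snoc p a)

  walk-reverse : ∀ {u v k} → Walk G u v k → Walk G v u k
  walk-reverse here       = here
  walk-reverse (step a p) = walk-snoc (walk-reverse p) (Adj-sym a)

  shortestPath-sym : ∀ {d} → IsShortestPathDistance G d → ∀ u v → d u v ≡ d v u
  shortestPath-sym {d} sp u v = ≤-antisym (≤-flip u v) (≤-flip v u)
    where
    ≤-flip : ∀ u v → d u v ≤ d v u
    ≤-flip u v = proj₂ (sp u v) (d v u) (walk-reverse (proj₁ (sp v u)))

foldr-⊔-upper : ∀ {A : Set} (f : A → ℕ) {a} {xs : List A} →
                a ∈ xs → f a ≤ foldr (λ x m → f x ⊔ m) 0 xs
foldr-⊔-upper f {a} (here refl) = m≤m⊔n (f a) _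
foldr-⊔-upper f {xs = x ∷ _} (there a∈xs) = m≤n⇒m≤o⊔n (f x) (foldr-⊔-upper f a∈xs)

foldr-⊔-least : ∀ {A : Set} (f : A → ℕ) {b} (xs : List A) →
                (∀ x → f x ≤ b) → foldr (λ x m → f x ⊔ m) 0 xs ≤ b
foldr-⊔-least f []       f≤b = z≤n
foldr-⊔-least f (x ∷ xs) f≤b = ⊔-lub (f≤b x) (foldr-⊔-least f xs f≤b)

foldr-⊓-lower : ∀ {A : Set} (f : A → ℕ) z {a} {xs : List A} →
                a ∈ xs → foldr (λ x m → f x ⊓ m) z xs ≤ f a
foldr-⊓-lower f z {a} (here refl) = m⊓n≤m (f a) _
foldr-⊓-lower f z {xs = x ∷ _} (there a∈xs) = ≤-trans (m⊓n≤n (f x) _) (foldr-⊓-lower f z a∈xs)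

module _ {n : ℕ} (d : Fin n → Fin n → ℕ) where

  dist≤ecc : ∀ v u → d v u ≤ ecc d v
  dist≤ecc v u = foldr-⊔-upper (d v) (∈-allFin u)

  ecc≤ : ∀ {v b} → (∀ u → d v u ≤ b) → ecc d v ≤ b
  ecc≤ {v} = foldr-⊔-least (d v) (allFin n)

  mutuallyDistant-dist≤ : (∀ u v → d u v ≡ d v u) → ∀ {x y} → MutuallyDistant d x y →
                          ∀ u → d x u ≤ d x y × d y u ≤ d x y
  mutuallyDistant-dist≤ d-sym {x} {y} (x∈Fy , y∈Fx) u =
    subst (d x u ≤_) (trans (sym y∈Fx) (d-sym y x)) (dist≤ecc x u) ,
    subst (d y u ≤_) (sym x∈Fy) (dist≤ecc y u)

  hyperbolic-≤ : ∀ {t} → Hyperbolic d t → ∀ u v w x {m} →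
                 d u w + d v x ≤ m → d u x + d v w ≤ m → d u v + d w x ≤ m + t
  hyperbolic-≤ {t} hyp u v w x s₂≤m s₃≤m =
    ≤-trans (proj₁ (hyp u v w x)) (+-monoˡ-≤ t (⊔-lub s₂≤m s₃≤m))

rad≤ecc : ∀ {n} (d : Fin (suc n) → Fin (suc n) → ℕ) v → rad d ≤ ecc d v
rad≤ecc d v = foldr-⊓-lower (ecc d) (ecc d fzero) (∈-allFin v)

⌈n/2⌉+⌈n/2⌉≤1+n : ∀ n → ⌈ n /2⌉ + ⌈ n /2⌉ ≤ suc n
⌈n/2⌉+⌈n/2⌉≤1+n n =
  subst (⌈ n /2⌉ + ⌈ n /2⌉ ≤_) (⌊n/2⌋+⌈n/2⌉≡n (suc n))
        (+-monoʳ-≤ ⌈ n /2⌉ (⌈n/2⌉-mono (n≤1+n n)))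

complement-of-⌈n/2⌉ : ∀ {a b n} → a + b ≡ n → a ≡ ⌈ n /2⌉ → b ≤ ⌈ n /2⌉
complement-of-⌈n/2⌉ {a} {b} {n} a+b≡n refl =
  subst (_≤ ⌈ n /2⌉) b≡⌊n/2⌋ (⌊n/2⌋≤⌈n/2⌉ n)
  where
  b≡⌊n/2⌋ : ⌊ n /2⌋ ≡ b
  b≡⌊n/2⌋ = +-cancelʳ-≡ ⌈ n /2⌉ ⌊ n /2⌋ b
              (trans (⌊n/2⌋+⌈n/2⌉≡n n) (trans (sym a+b≡n) (+-comm a b)))

slice-⌈/2⌉-dist≤ : ∀ {n} {d : Fin n → Fin n → ℕ} → (∀ u v → d u v ≡ d v u) →
                   ∀ {x y c} → InSlice d ⌈ d x y /2⌉ x y c →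
                   d x c ≤ ⌈ d x y /2⌉ × d y c ≤ ⌈ d x y /2⌉
slice-⌈/2⌉-dist≤ {d = d} d-sym {x} {y} {c} (c∈I , dcx≡h) =
  ≤-reflexive xc≡h , subst (_≤ ⌈ d x y /2⌉) (d-sym c y) (complement-of-⌈n/2⌉ c∈I xc≡h)
  where
  xc≡h = trans (d-sym x c) dcx≡h

midpointSlice-dist≤ : ∀ {n} {d : Fin n → Fin n → ℕ} → (∀ u v → d u v ≡ d v u) →
                      ∀ {x y c} → InSlice d ⌈ d x y /2⌉ x y c ⊎ InSlice d ⌈ d x y /2⌉ y x c →
                      d x c ≤ ⌈ d x y /2⌉ × d y c ≤ ⌈ d x y /2⌉
midpointSlice-dist≤ d-sym (inj₁ c∈Sxy) = slice-⌈/2⌉-dist≤ d-sym c∈Sxy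
midpointSlice-dist≤ {d = d} d-sym {x} {y} (inj₂ c∈Syx) rewrite d-sym x y =
  swap (slice-⌈/2⌉-dist≤ d-sym c∈Syx)

module _ {n : ℕ} {d : Fin n → Fin n → ℕ} (d-sym : ∀ u v → d u v ≡ d v u)
         {t : ℕ} (hyp : Hyperbolic d t) {x y : Fin n} (xy-far : MutuallyDistant d x y) where

  ecc-between-far-pair≤ : ∀ {c h} → d x c ≤ h → d y c ≤ h → ecc d c ≤ h + t
  ecc-between-far-pair≤ {c} {h} xc≤h yc≤h = ecc≤ d λ u →
    +-cancelˡ-≤ (d x y) _ _ (subst (d x y + d c u ≤_) (+-assoc (d x y) h t)
      (hyperbolic-≤ d hyp x y c u
        (subst (d x c + d y u ≤_) (+-comm h (d x y)) (+-mono-≤ xc≤h (proj₂ (far u))))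
        (+-mono-≤ (proj₁ (far u)) yc≤h)))
    where
    far = mutuallyDistant-dist≤ d d-sym xy-far

  far-pair+dist≤ : ∀ {c v h r} → d x c ≤ h → d y c ≤ h → ecc d v ≤ r →
                   d x y + d v c ≤ r + h + t
  far-pair+dist≤ {c} {v} {h} {r} xc≤h yc≤h ecc-v≤r =
    hyperbolic-≤ d hyp x y v c (+-mono-≤ (v-close x) yc≤h)
      (subst (d x c + d y v ≤_) (+-comm h r) (+-mono-≤ xc≤h (v-close y)))
    where
    v-close : ∀ u → d u v ≤ r
    v-close u = subst (_≤ r) (d-sym v u) (≤-trans (dist≤ecc d v u) ecc-v≤r)

centre-slack : ∀ h t k D → h + h ≤ suc D → (h + t + k) + h + t ≤ D + (t + t + 1 + k)
centre-slack h t k D 2h≤1+D = begin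
  (h + t + k) + h + t     ≡⟨ solve 3 (λ h t k → h :+ t :+ k :+ h :+ t := (h :+ h) :+ (t :+ t :+ k)) refl h t k ⟩
  (h + h) + (t + t + k)   ≤⟨ +-monoˡ-≤ (t + t + k) 2h≤1+D ⟩
  suc D + (t + t + k)     ≡⟨ solve 3 (λ D t k → con 1 :+ D :+ (t :+ t :+ k) := D :+ (t :+ t :+ con 1 :+ k)) refl D t k ⟩
  D + (t + t + 1 + k)     ∎
  where
  open ≤-Reasoning
  open +-*-Solver

lemma34 : ∀ {n} (G : Graph (suc n)) (d : Fin (suc n) → Fin (suc n) → ℕ) (t : ℕ) →
            Connected G → IsShortestPathDistance G d → Hyperbolic d t →
            ∀ (x y : Fin (suc n)) → MutuallyDistant d x y →
            ∀ (c : Fin (suc n)) →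
            (InSlice d ⌈ d x y /2⌉ x y c ⊎ InSlice d ⌈ d x y /2⌉ y x c) →
            ∀ (k : ℕ) (v : Fin (suc n)) → InCentre≤ d k v → InDisk d c (t + t + 1 + k) v
lemma34 G d t _ sp hyp x y xy-far c c∈slice k v v∈C =
  +-cancelˡ-≤ D _ _ (begin
    D + d v c              ≤⟨ far-pair+dist≤ d-sym hyp xy-far xc≤h yc≤h ecc-v≤ ⟩
    (h + t + k) + h + t    ≤⟨ centre-slack h t k D (⌈n/2⌉+⌈n/2⌉≤1+n D) ⟩
    D + (t + t + 1 + k)    ∎)
  where
  open ≤-Reasoning
  d-sym = shortestPath-sym G sp
  D = d x y
  h = ⌈ D /2⌉
  xc≤h = proj₁ (midpointSlice-dist≤ d-sym c∈slice)
  yc≤h = proj₂ (midpointSlice-dist≤ d-sym c∈slice)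
  rad≤h+t : rad d ≤ h + t
  rad≤h+t = ≤-trans (rad≤ecc d c) (ecc-between-far-pair≤ d-sym hyp xy-far xc≤h yc≤h)
  ecc-v≤ : ecc d v ≤ h + t + k
  ecc-v≤ = ≤-trans v∈C (+-monoˡ-≤ k rad≤h+t)
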